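{- Let $s,t$ be positive integers. Define $(Q_n)_{n\ge0}$ as follows: for each $n\ge 0$, if $n=tQ_m+sm$ for some $m<n$ such that the value $Q_m$ occurs exactly once among $Q_0,\dots,Q_{n-1}$, then $Q_n=Q_m$; otherwise $Q_n=\operatorname{mex}\{Q_m:0\le m<n\}$. For each $n$ let $A'_n$ be the smallest $k$ with $Q_k=n$ and $B'_n$ the largest $k$ with $Q_k=n$. Define also $(A_n)_{n\ge0}$, $(B_n)_{n\ge0}$ by $A_n=\operatorname{mex}\{A_i,B_i:0\le i<n\}$ and $B_n=sA_n+tn$. Then $A'_n=A_n$ and $B'_n=B_n$ for all positive integers $n$.
   Context: For a finite set $S$ of nonnegative integers, $\operatorname{mex} S$ is the least nonnegative integer not in $S$ (so $\operatorname{mex}\emptyset=0$). -}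

module Defs where

open import Data.Nat using (ℕ; zero; suc; _+_; _*_; _<_; _≡ᵇ_)
open import Data.Nat.Properties using (_≟_)
open import Data.List using (List; []; _∷_; length; map; upTo; filter)
open import Data.Bool.ListAction using (any)
open import Data.Product using (∃; _×_)
open import Data.Sum using (_⊎_)
open import Data.Bool using (Bool; true; false)
open import Relation.Nullary using (¬_)
open import Relation.Binary.PropositionalEquality using (_≡_)

_∈ᵇ_ : ℕ → List ℕ → Bool
k ∈ᵇ l = any (λ x → x ≡ᵇ k) l

-- mex of the finite set of elements of a list: the least k not in the list.
-- Search starting at k, with fuel; fuel = length l suffices since mex l ≤ length l.
mexSearch : ℕ → ℕ → List ℕ → ℕ
mexSearch fuel k l with k ∈ᵇ l
... | false = k
mexSearch zero     k l | true = k
mexSearch (suc f)  k l | true = mexSearch f (suc k) l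

mex : List ℕ → ℕ
mex l = mexSearch (length l) 0 l

count : ℕ → List ℕ → ℕ
count v l = length (filter (_≟ v) l)

prefix : (ℕ → ℕ) → ℕ → List ℕ
prefix Q n = map Q (upTo n)

QRule : ℕ → ℕ → (ℕ → ℕ) → ℕ → Set
QRule s t Q n =
  (∃ λ m → m < n × n ≡ t * Q m + s * m × count (Q m) (prefix Q n) ≡ 1 × Q n ≡ Q m)
  ⊎ ((¬ ∃ λ m → m < n × n ≡ t * Q m + s * m × count (Q m) (prefix Q n) ≡ 1)
     × Q n ≡ mex (prefix Q n))

IsQ : ℕ → ℕ → (ℕ → ℕ) → Set
IsQ s t Q = ∀ n → QRule s t Q n

ABlist : ℕ → ℕ → ℕ → List ℕ
ABlist s t zero = []
ABlist s t (suc n) = a ∷ (s * a + t * n) ∷ ABlist s t n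
  where a = mex (ABlist s t n)

A : ℕ → ℕ → ℕ → ℕ
A s t n = mex (ABlist s t n)

B : ℕ → ℕ → ℕ → ℕ
B s t n = s * A s t n + t * n

IsFirst : (ℕ → ℕ) → ℕ → ℕ → Set
IsFirst Q v k = Q k ≡ v × (∀ j → j < k → ¬ Q j ≡ v)

IsLast : (ℕ → ℕ) → ℕ → ℕ → Set
IsLast Q v k = Q k ≡ v × (∀ j → k < j → ¬ Q j ≡ v)

{-# OPTIONS --safe #-}
module Submission where

-- Every index k is A_{Q_k} or B_{Q_k}, proved by strong induction on k. The A's and B's
-- cover ℕ, overlapping only in A₀ = B₀ = 0, A is increasing and A_v ≤ B_v, so this locates
-- the first and last occurrence of every value. The repetition rule at n can only copy Q_m
-- from m = A_{Q_m}: m = B_v with v > 0 would make v occur twice (at A_v and B_v) before n.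
-- So it fires only at n = t Q_m + s A_{Q_m} = B_{Q_m}. Hence at n = A_w the mex rule
-- applies, and the values of Q below n are exactly those j with A_j < n, i.e. j < w; at
-- n = B_w (w > 0) the rule repeats w, copied from its unique earlier occurrence A_w.

open import Defs
open import Data.Bool using (false; true; T)
open import Data.Empty using (⊥-elim)
open import Data.Fin using (toℕ)
open import Data.Fin.Properties using (pigeonhole; toℕ<n)
open import Data.List using (List; [_]; _++_; length; map; upTo; filter; lookup)
open import Data.List.Membership.Propositional using (_∈_; _∉_)
open import Data.List.Membership.Propositional.Properties
  using (∈-map⁺; ∈-map⁻; ∈-upTo⁺; ∈-upTo⁻)
open import Data.List.Properties
  using (map-++; upTo-∷ʳ; filter-accept; filter-reject; filter-++; length-++)
open import Data.List.Relation.Binary.Subset.Propositional using (_⊆_)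
open import Data.List.Relation.Unary.Any as Any using (here; there; index)
open import Data.List.Relation.Unary.Any.Properties using (any⁺; any⁻; lookup-index)
open import Data.Nat
  using (ℕ; zero; suc; _+_; _*_; _≤_; _<_; _≡ᵇ_; z≤n; s≤s; z<s; _≤′_; ≤′-refl; ≤′-step;
         NonZero; >-nonZero)
open import Data.Nat.Induction using (<-rec)
open import Data.Nat.Properties
open import Data.Product using (_×_; ∃; _,_; proj₁; proj₂)
open import Data.Sum using (_⊎_; inj₁; inj₂)
open import Data.Unit using (tt)
open import Function using (_∘_)
open import Function.Definitions using (Injective)
open import Relation.Binary.Definitions using (Monotonic₁; tri<; tri≈; tri>)
open import Relation.Binary.PropositionalEquality
  using (_≡_; refl; sym; trans; cong; cong₂; subst; subst₂; module ≡-Reasoning)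
open import Relation.Nullary using (¬_; yes; no; contradiction)

∈ᵇ⇒∈ : ∀ {k l} → T (k ∈ᵇ l) → k ∈ l
∈ᵇ⇒∈ {k} {l} h = Any.map (λ {x} x≡ᵇk → sym (≡ᵇ⇒≡ x k x≡ᵇk)) (any⁻ (_≡ᵇ k) l h)

∈⇒∈ᵇ : ∀ {k l} → k ∈ l → T (k ∈ᵇ l)
∈⇒∈ᵇ {k} k∈l = any⁺ (_≡ᵇ k) (Any.map (λ { refl → ≡⇒≡ᵇ k k refl }) k∈l)

Covers : List ℕ → ℕ → Set
Covers l k = ∀ {j} → j < k → j ∈ l

Covers-suc : ∀ {l k} → Covers l k → k ∈ l → Covers l (suc k)
Covers-suc cov k∈l j<1+k with m<1+n⇒m<n∨m≡n j<1+k
... | inj₁ j<k  = cov j<k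
... | inj₂ refl = k∈l

-- Pigeonhole: send each j < k to the position of one of its occurrences in l.
Covers⇒≤length : ∀ {l k} → Covers l k → k ≤ length l
Covers⇒≤length {l} {k} cov with k ≤? length l
... | yes k≤∣l∣ = k≤∣l∣
... | no  k≰∣l∣ with i , j , i<j , same ← pigeonhole (≰⇒> k≰∣l∣) (index ∘ cov ∘ toℕ<n) =
  contradiction (begin
    toℕ i                            ≡⟨ lookup-index (cov (toℕ<n i)) ⟩
    lookup l (index (cov (toℕ<n i))) ≡⟨ cong (lookup l) same ⟩
    lookup l (index (cov (toℕ<n j))) ≡⟨ lookup-index (cov (toℕ<n j)) ⟨
    toℕ j                            ∎) (<⇒≢ i<j)
  where open ≡-Reasoning

mexSearch-spec : ∀ f k l → Covers l k → length l ≤ k + f →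
                 Covers l (mexSearch f k l) × mexSearch f k l ∉ l
mexSearch-spec f k l cov ∣l∣≤k+f with k ∈ᵇ l in k∈ᵇl
... | false = cov , λ k∈l → subst T k∈ᵇl (∈⇒∈ᵇ k∈l)
mexSearch-spec zero k l cov ∣l∣≤k+0 | true =
  ⊥-elim (<⇒≱ (Covers⇒≤length (Covers-suc cov (∈ᵇ⇒∈ (subst T (sym k∈ᵇl) tt))))
              (subst (length l ≤_) (+-identityʳ k) ∣l∣≤k+0))
mexSearch-spec (suc f) k l cov ∣l∣≤k+1+f | true =
  mexSearch-spec f (suc k) l (Covers-suc cov (∈ᵇ⇒∈ (subst T (sym k∈ᵇl) tt)))
                 (subst (length l ≤_) (+-suc k f) ∣l∣≤k+1+f)

mex-covers : ∀ l → Covers l (mex l)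
mex-covers l = proj₁ (mexSearch-spec (length l) 0 l (λ ()) ≤-refl)

mex-∉ : ∀ l → mex l ∉ l
mex-∉ l = proj₂ (mexSearch-spec (length l) 0 l (λ ()) ≤-refl)

mex-unique : ∀ {l k} → Covers l k → k ∉ l → mex l ≡ k
mex-unique {l} {k} cov k∉l with <-cmp (mex l) k
... | tri< mex<k _ _ = contradiction (cov mex<k) (mex-∉ l)
... | tri≈ _ mex≡k _ = mex≡k
... | tri> _ _ k<mex = contradiction (mex-covers l k<mex) k∉l

mex-mono : ∀ {l l′} → l ⊆ l′ → mex l ≤ mex l′
mex-mono {l} {l′} l⊆l′ with ≤-<-connex (mex l) (mex l′)
... | inj₁ mex≤mex′ = mex≤mex′
... | inj₂ mex′<mex = contradiction (l⊆l′ (mex-covers l mex′<mex)) (mex-∉ l′)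

∈-prefix⁺ : ∀ Q {n k} → k < n → Q k ∈ prefix Q n
∈-prefix⁺ Q k<n = ∈-map⁺ Q (∈-upTo⁺ k<n)

∈-prefix⁻ : ∀ Q {n x} → x ∈ prefix Q n → ∃ λ k → k < n × x ≡ Q k
∈-prefix⁻ Q x∈ with k , k∈ , x≡Qk ← ∈-map⁻ Q x∈ = k , ∈-upTo⁻ k∈ , x≡Qk

prefix-suc : ∀ Q n → prefix Q (suc n) ≡ prefix Q n ++ [ Q n ]
prefix-suc Q n = trans (cong (map Q) (sym (upTo-∷ʳ n))) (map-++ Q (upTo n) [ n ])

count-++ : ∀ v xs ys → count v (xs ++ ys) ≡ count v xs + count v ys
count-++ v xs ys = trans (cong length (filter-++ (_≟ v) xs ys)) (length-++ (filter (_≟ v) xs))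

count-[≡] : ∀ {v x} → x ≡ v → count v [ x ] ≡ 1
count-[≡] {v} x≡v = cong length (filter-accept (_≟ v) x≡v)

count-[≢] : ∀ {v x} → ¬ x ≡ v → count v [ x ] ≡ 0
count-[≢] {v} x≢v = cong length (filter-reject (_≟ v) x≢v)

module _ (Q : ℕ → ℕ) {v : ℕ} where

  count-prefix-at : ∀ {n} → Q n ≡ v → count v (prefix Q (suc n)) ≡ suc (count v (prefix Q n))
  count-prefix-at {n} Qn≡v = begin
    count v (prefix Q (suc n))             ≡⟨ cong (count v) (prefix-suc Q n) ⟩
    count v (prefix Q n ++ [ Q n ])        ≡⟨ count-++ v (prefix Q n) [ Q n ] ⟩
    count v (prefix Q n) + count v [ Q n ] ≡⟨ cong (count v (prefix Q n) +_) (count-[≡] Qn≡v) ⟩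
    count v (prefix Q n) + 1               ≡⟨ +-comm (count v (prefix Q n)) 1 ⟩
    suc (count v (prefix Q n))             ∎
    where open ≡-Reasoning

  count-prefix-not-at : ∀ {n} → ¬ Q n ≡ v → count v (prefix Q (suc n)) ≡ count v (prefix Q n)
  count-prefix-not-at {n} Qn≢v = begin
    count v (prefix Q (suc n))             ≡⟨ cong (count v) (prefix-suc Q n) ⟩
    count v (prefix Q n ++ [ Q n ])        ≡⟨ count-++ v (prefix Q n) [ Q n ] ⟩
    count v (prefix Q n) + count v [ Q n ] ≡⟨ cong (count v (prefix Q n) +_) (count-[≢] Qn≢v) ⟩
    count v (prefix Q n) + 0               ≡⟨ +-identityʳ (count v (prefix Q n)) ⟩
    count v (prefix Q n)                   ∎
    where open ≡-Reasoning

  count-prefix-mono : ∀ {m n} → m ≤ n → count v (prefix Q m) ≤ count v (prefix Q n)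
  count-prefix-mono = go ∘ ≤⇒≤′
    where
    go : ∀ {m n} → m ≤′ n → count v (prefix Q m) ≤ count v (prefix Q n)
    go ≤′-refl = ≤-refl
    go (≤′-step {n} m≤′n) with Q n ≟ v
    ... | yes Qn≡v = ≤-trans (go m≤′n) (≤-trans (n≤1+n _) (≤-reflexive (sym (count-prefix-at Qn≡v))))
    ... | no  Qn≢v = ≤-trans (go m≤′n) (≤-reflexive (sym (count-prefix-not-at Qn≢v)))

  count-prefix-≡0 : ∀ {n} → (∀ {k} → k < n → ¬ Q k ≡ v) → count v (prefix Q n) ≡ 0
  count-prefix-≡0 {zero}  _    = refl
  count-prefix-≡0 {suc n} none =
    trans (count-prefix-not-at (none ≤-refl)) (count-prefix-≡0 (none ∘ m<n⇒m<1+n))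

  count-prefix-≡1 : ∀ {m n} → m < n → Q m ≡ v → (∀ {k} → k < n → Q k ≡ v → k ≡ m) →
                    count v (prefix Q n) ≡ 1
  count-prefix-≡1 {m} {suc n} m<1+n Qm≡v only-m with m<1+n⇒m<n∨m≡n m<1+n
  ... | inj₂ refl = trans (count-prefix-at Qm≡v) (cong suc (count-prefix-≡0 none-before))
    where
    none-before : ∀ {k} → k < m → ¬ Q k ≡ v
    none-before k<m Qk≡v = <⇒≢ k<m (only-m (m<n⇒m<1+n k<m) Qk≡v)
  ... | inj₁ m<n  = trans (count-prefix-not-at (<⇒≢ m<n ∘ sym ∘ only-m ≤-refl))
                          (count-prefix-≡1 m<n Qm≡v (only-m ∘ m<n⇒m<1+n))

  count-prefix-≥2 : ∀ {i j n} → i < j → j < n → Q i ≡ v → Q j ≡ v → 2 ≤ count v (prefix Q n)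
  count-prefix-≥2 {i} {j} {n} i<j j<n Qi≡v Qj≡v = begin
    2                                ≤⟨ s≤s (s≤s z≤n) ⟩
    suc (suc (count v (prefix Q i))) ≡⟨ cong suc (count-prefix-at Qi≡v) ⟨
    suc (count v (prefix Q (suc i))) ≤⟨ s≤s (count-prefix-mono i<j) ⟩
    suc (count v (prefix Q j))       ≡⟨ count-prefix-at Qj≡v ⟨
    count v (prefix Q (suc j))       ≤⟨ count-prefix-mono j<n ⟩
    count v (prefix Q n)             ∎
    where open ≤-Reasoning

module _ {f : ℕ → ℕ} where

  step-<⇒strictMono : (∀ n → f n < f (suc n)) → Monotonic₁ _<_ _<_ f
  step-<⇒strictMono step {_} {suc j} i<1+j with m<1+n⇒m<n∨m≡n i<1+j
  ... | inj₁ i<j  = <-trans (step-<⇒strictMono step i<j) (step j)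
  ... | inj₂ refl = step j

  strictMono⇒injective : Monotonic₁ _<_ _<_ f → Injective _≡_ _≡_ f
  strictMono⇒injective mono {i} {j} fi≡fj with <-cmp i j
  ... | tri< i<j _ _ = contradiction fi≡fj (<⇒≢ (mono i<j))
  ... | tri≈ _ i≡j _ = i≡j
  ... | tri> _ _ j<i = contradiction (sym fi≡fj) (<⇒≢ (mono j<i))

module _ (s t : ℕ) where

  private
    a b : ℕ → ℕ
    a = A s t
    b = B s t

  A∈ABlist : ∀ {i n} → i < n → a i ∈ ABlist s t n
  A∈ABlist {n = suc n} i<1+n with m<1+n⇒m<n∨m≡n i<1+n
  ... | inj₁ i<n  = there (there (A∈ABlist i<n))
  ... | inj₂ refl = here refl

  B∈ABlist : ∀ {i n} → i < n → b i ∈ ABlist s t n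
  B∈ABlist {n = suc n} i<1+n with m<1+n⇒m<n∨m≡n i<1+n
  ... | inj₁ i<n  = there (there (B∈ABlist i<n))
  ... | inj₂ refl = there (here refl)

  ∈ABlist⁻ : ∀ {x n} → x ∈ ABlist s t n → ∃ λ i → i < n × (x ≡ a i ⊎ x ≡ b i)
  ∈ABlist⁻ {n = suc n} (here x≡aₙ)         = n , ≤-refl , inj₁ x≡aₙ
  ∈ABlist⁻ {n = suc n} (there (here x≡bₙ)) = n , ≤-refl , inj₂ x≡bₙ
  ∈ABlist⁻ {n = suc n} (there (there x∈))  with i , i<n , x≡ ← ∈ABlist⁻ x∈ =
    i , m<n⇒m<1+n i<n , x≡

  A-step : ∀ n → a n < a (suc n)
  A-step n = ≤∧≢⇒< (mex-mono {ABlist s t n} {ABlist s t (suc n)} (there ∘ there))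
    (λ aₙ≡aₙ₊₁ → mex-∉ (ABlist s t (suc n)) (subst (_∈ ABlist s t (suc n)) aₙ≡aₙ₊₁ (here refl)))

  A-strictMono : Monotonic₁ _<_ _<_ a
  A-strictMono = step-<⇒strictMono A-step

  A-injective : Injective _≡_ _≡_ a
  A-injective = strictMono⇒injective A-strictMono

  n≤A : ∀ n → n ≤ a n
  n≤A zero    = z≤n
  n≤A (suc n) = ≤-<-trans (n≤A n) (A-step n)

  A⊎B-surjective : ∀ k → ∃ λ w → k ≡ a w ⊎ k ≡ b w
  A⊎B-surjective k with w , _ , k≡ ← ∈ABlist⁻ (mex-covers (ABlist s t (suc k)) (n≤A (suc k))) =
    w , k≡

  module _ .{{_ : NonZero s}} .{{_ : NonZero t}} where

    A≤B : ∀ n → a n ≤ b n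
    A≤B n = ≤-trans (m≤n*m (a n) s) (m≤m+n (s * a n) (t * n))

    A<B : ∀ {n} → 0 < n → a n < b n
    A<B {n} 0<n = ≤-<-trans (m≤n*m (a n) s)
      (m<m+n (s * a n) (subst (_< t * n) (*-zeroʳ t) (*-monoʳ-< t 0<n)))

    n≤B : ∀ n → n ≤ b n
    n≤B n = ≤-trans (n≤A n) (A≤B n)

    B-strictMono : Monotonic₁ _<_ _<_ b
    B-strictMono i<j = +-mono-≤-< (*-monoʳ-≤ s (<⇒≤ (A-strictMono i<j))) (*-monoʳ-< t i<j)

    B-injective : Injective _≡_ _≡_ b
    B-injective = strictMono⇒injective B-strictMono

    B0≡0 : b 0 ≡ 0
    B0≡0 = cong₂ _+_ (*-zeroʳ s) (*-zeroʳ t)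

    A≡B⇒≡0 : ∀ {v u} → a v ≡ b u → v ≡ 0 × u ≡ 0
    A≡B⇒≡0 {zero}  {u} a₀≡bᵤ = refl , n≤0⇒n≡0 (≤-trans (n≤B u) (≤-reflexive (sym a₀≡bᵤ)))
    A≡B⇒≡0 {suc v} {u} aᵥ≡bᵤ with <-cmp u (suc v)
    ... | tri< u<v _ _  =
      contradiction (subst (_∈ ABlist s t (suc v)) (sym aᵥ≡bᵤ) (B∈ABlist u<v)) (mex-∉ _)
    ... | tri≈ _ refl _ = contradiction aᵥ≡bᵤ (<⇒≢ (A<B z<s))
    ... | tri> _ _ v<u  =
      contradiction aᵥ≡bᵤ (<⇒≢ (<-trans (A-strictMono v<u) (A<B (<-trans z<s v<u))))

    B<rule⇒0< : ∀ {v} → b v < t * v + s * b v → 0 < v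
    B<rule⇒0< {zero}  b₀<rule = contradiction (subst₂ _<_ B0≡0 rule₀≡0 b₀<rule) (<-irrefl refl)
      where rule₀≡0 = cong₂ _+_ (*-zeroʳ t) (trans (cong (s *_) B0≡0) (*-zeroʳ s))
    B<rule⇒0< {suc v} _       = z<s

    module _ (Q : ℕ → ℕ) where

      AtAorB : ℕ → Set
      AtAorB k = k ≡ a (Q k) ⊎ k ≡ b (Q k)

      AtAorB-below : ℕ → Set
      AtAorB-below n = ∀ {k} → k < n → AtAorB k

      AtAorB⇒A≤×≤B : ∀ {k} → AtAorB k → a (Q k) ≤ k × k ≤ b (Q k)
      AtAorB⇒A≤×≤B (inj₁ k≡a) = ≤-reflexive (sym k≡a) , ≤-trans (≤-reflexive k≡a) (A≤B _)
      AtAorB⇒A≤×≤B (inj₂ k≡b) = ≤-trans (A≤B _) (≤-reflexive (sym k≡b)) , ≤-reflexive k≡b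

      Q-at-A : ∀ {v} → AtAorB (a v) → Q (a v) ≡ v
      Q-at-A (inj₁ aᵥ≡a) = sym (A-injective aᵥ≡a)
      Q-at-A (inj₂ aᵥ≡b) with v≡0 , Q≡0 ← A≡B⇒≡0 aᵥ≡b = trans Q≡0 (sym v≡0)

      Q-at-B : ∀ {v} → AtAorB (b v) → Q (b v) ≡ v
      Q-at-B (inj₁ bᵥ≡a) with Q≡0 , v≡0 ← A≡B⇒≡0 (sym bᵥ≡a) = trans Q≡0 (sym v≡0)
      Q-at-B (inj₂ bᵥ≡b) = sym (B-injective bᵥ≡b)

      CanRepeat : ℕ → ℕ → Set
      CanRepeat m n = m < n × n ≡ t * Q m + s * m × count (Q m) (prefix Q n) ≡ 1

      module _ {n} (ih : AtAorB-below n) where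

        prefix-covers : ∀ {w} → a w ≤ n → Covers (prefix Q n) w
        prefix-covers aᵥ≤n j<w = subst (_∈ prefix Q n) (Q-at-A (ih aⱼ<n)) (∈-prefix⁺ Q aⱼ<n)
          where aⱼ<n = <-≤-trans (A-strictMono j<w) aᵥ≤n

        ∉-prefix : ∀ {w} → n ≤ a w → w ∉ prefix Q n
        ∉-prefix n≤aᵥ w∈ with k , k<n , refl ← ∈-prefix⁻ Q w∈ =
          <⇒≱ k<n (≤-trans n≤aᵥ (proj₁ (AtAorB⇒A≤×≤B (ih k<n))))

        count-≥2-past-B : ∀ {v} → 0 < v → b v < n → 2 ≤ count v (prefix Q n)
        count-≥2-past-B 0<v bᵥ<n =
          count-prefix-≥2 Q (A<B 0<v) bᵥ<n (Q-at-A (ih aᵥ<n)) (Q-at-B (ih bᵥ<n))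
          where aᵥ<n = <-trans (A<B 0<v) bᵥ<n

        CanRepeat⇒B : ∀ {m} → CanRepeat m n → n ≡ b (Q m)
        CanRepeat⇒B {m} (m<n , n≡rule , once) with ih m<n
        ... | inj₁ m≡a =
          trans n≡rule (trans (cong (λ x → t * Q m + s * x) m≡a) (+-comm (t * Q m) _))
        ... | inj₂ m≡b =
          contradiction once (>⇒≢ (count-≥2-past-B (B<rule⇒0< bQₘ<rule) (subst (_< n) m≡b m<n)))
          where bQₘ<rule = subst₂ _<_ m≡b (trans n≡rule (cong (λ x → t * Q m + s * x) m≡b)) m<n

        CanRepeat-A-at-B : ∀ {w} → 0 < w → n ≡ b w → CanRepeat (a w) n
        CanRepeat-A-at-B {w} 0<w n≡b = aᵥ<n , n≡rule , count-prefix-≡1 Q aᵥ<n refl only-aᵥ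
          where
          aᵥ<n = subst (a w <_) (sym n≡b) (A<B 0<w)
          Qaᵥ≡w = Q-at-A (ih aᵥ<n)
          n≡rule = trans n≡b (trans (+-comm (s * a w) (t * w))
                                    (cong (λ x → t * x + s * a w) (sym Qaᵥ≡w)))
          only-aᵥ : ∀ {k} → k < n → Q k ≡ Q (a w) → k ≡ a w
          only-aᵥ {k} k<n Qk≡ with ih k<n
          ... | inj₁ k≡a = trans k≡a (cong a (trans Qk≡ Qaᵥ≡w))
          ... | inj₂ k≡b =
            contradiction (trans k≡b (trans (cong b (trans Qk≡ Qaᵥ≡w)) (sym n≡b))) (<⇒≢ k<n)

        module _ (isQ : IsQ s t Q) where

          AtAorB-at-A : ∀ {w} → n ≡ a w → AtAorB n
          AtAorB-at-A {w} n≡a with isQ n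
          ... | inj₁ (m , m<n , n≡rule , once , _)
              with w≡0 , _ ← A≡B⇒≡0 {w} (trans (sym n≡a) (CanRepeat⇒B (m<n , n≡rule , once))) =
            contradiction (subst (m <_) (trans n≡a (cong a w≡0)) m<n) n≮0
          ... | inj₂ (_ , Qn≡mex) = inj₁ (trans n≡a (cong a (sym Qn≡w)))
            where
            Qn≡w : Q n ≡ w
            Qn≡w = trans Qn≡mex (mex-unique (prefix-covers {w} (≤-reflexive (sym n≡a)))
                                            (∉-prefix {w} (≤-reflexive n≡a)))

          AtAorB-at-B : ∀ {w} → 0 < w → n ≡ b w → AtAorB n
          AtAorB-at-B 0<w n≡b with isQ n
          ... | inj₁ (m , m<n , n≡rule , once , Qn≡Qm) =
            inj₂ (trans (CanRepeat⇒B (m<n , n≡rule , once)) (cong b (sym Qn≡Qm)))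
          ... | inj₂ (cannot , _) = contradiction (_ , CanRepeat-A-at-B 0<w n≡b) cannot

          AtAorB-step : AtAorB n
          AtAorB-step with A⊎B-surjective n
          ... | w     , inj₁ n≡a = AtAorB-at-A {w} n≡a
          ... | zero  , inj₂ n≡b = AtAorB-at-A {0} (trans n≡b B0≡0)
          ... | suc _ , inj₂ n≡b = AtAorB-at-B z<s n≡b

      module _ (isQ : IsQ s t Q) where

        atAorB : ∀ n → AtAorB n
        atAorB = <-rec AtAorB (λ n ih → AtAorB-step ih isQ)

        A-first : ∀ v → IsFirst Q v (a v)
        A-first v = Q-at-A (atAorB (a v)) , not-before
          where
          not-before : ∀ j → j < a v → ¬ Q j ≡ v
          not-before j j<aᵥ Qj≡v =
            <⇒≱ j<aᵥ (subst (λ u → a u ≤ j) Qj≡v (proj₁ (AtAorB⇒A≤×≤B (atAorB j))))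

        B-last : ∀ v → IsLast Q v (b v)
        B-last v = Q-at-B (atAorB (b v)) , not-after
          where
          not-after : ∀ j → b v < j → ¬ Q j ≡ v
          not-after j bᵥ<j Qj≡v =
            <⇒≱ bᵥ<j (subst (λ u → j ≤ b u) Qj≡v (proj₂ (AtAorB⇒A≤×≤B (atAorB j))))

theorem4 : (s t : ℕ) → 1 ≤ s → 1 ≤ t → (Q : ℕ → ℕ) → IsQ s t Q →
    ∀ n → 1 ≤ n → IsFirst Q n (A s t n) × IsLast Q n (B s t n)
theorem4 s t 1≤s 1≤t Q isQ n _ =
  A-first s t {{>-nonZero 1≤s}} {{>-nonZero 1≤t}} Q isQ n ,
  B-last  s t {{>-nonZero 1≤s}} {{>-nonZero 1≤t}} Q isQ n
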